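{- Let $m\ge 2$, let $q$ be a prime power, and let $\mathcal A$ be an affine $(d,k,\lambda)$-BIBD on the point set $\{1,\dots,d\}$ with $d=q^m$, $k=q^{m-1}$ and $\lambda=(q^{m-1}-1)/(q-1)$. For $\beta\in\mathcal A$ let $D_\beta$ be the $d\times d$ diagonal matrix with $(D_\beta)_{j,j}=1$ if $j\in\beta$ and all other entries $0$. Then $\{(1/k)D_\beta\}_{\beta\in\mathcal A}$ consists of $n=q(q^m-1)/(q-1)$ classical states which are orthoplex-bound achieving in the set of non-negative, trace-one diagonal $d\times d$ matrices; that is, $n>d$ and $\max_{\beta\ne\beta'}\mathrm{tr}\big((1/k)D_\beta\,(1/k)D_{\beta'}\big)=1/d$.
   Context: A $(v,k,\lambda)$-BIBD is a collection $\mathcal B$ of subsets (blocks) of $\{1,\dots,v\}$, each of size $k$, such that every pair of distinct points is contained in exactly $\lambda$ blocks. It is affine if $\mathcal B$ can be partitioned into parallel classes, each of which partitions $\{1,\dots,v\}$, and there is $\mu\in\mathbb N$ with $|\beta\cap\beta'|=\mu$ whenever $\beta,\beta'$ lie in different parallel classes. A classical state is a $d\times d$ diagonal positive semidefinite matrix with trace $1$. The set of classical states is a spectrahedron of dimension $D=d-1$; an arrangement $\{W_j\}_{j=1}^n$ in it is called orthoplex-bound achieving if $n>D+1$ and $\max_{j\neq l}\mathrm{tr}(W_jW_l)=1/d$. -}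

module Defs where

open import Data.Nat as ℕ using (ℕ; zero; suc; _∸_; _^_)
open import Data.Bool using (Bool; true; false; _∧_)
open import Data.Fin using (Fin; zero; suc)
open import Data.Fin.Subset using (Subset; _∈_; _∩_; ∣_∣; inside; outside)
open import Data.Fin.Subset.Properties using (_∈?_)
open import Data.Fin.Properties using () renaming (_≟_ to _≟ᶠ_)
open import Data.Vec using (lookup)
open import Data.Integer using (+_)
open import Data.Rational using (ℚ; 0ℚ; 1ℚ; _/_; _*_; _+_; _≤_)
open import Data.Product using (Σ; _×_; _,_; ∃)
open import Relation.Nullary using (¬_; does)
open import Relation.Binary.PropositionalEquality using (_≡_; _≢_)
open import Data.Nat.Primality using (Prime)

count : ∀ {b} → (Fin b → Bool) → ℕ
count {zero} P = 0
count {suc b} P with P zero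
... | true  = suc (count (λ i → P (suc i)))
... | false = count (λ i → P (suc i))

IsPrimePower : ℕ → Set
IsPrimePower q = Σ ℕ λ p → Σ ℕ λ e → Prime p × 1 ℕ.≤ e × q ≡ p ^ e

mem : ∀ {d} → Fin d → Subset d → Bool
mem x β = does (x ∈? β)

-- A design: b blocks β : Fin b → Subset d, pairwise distinct (a collection = set of blocks)
-- (v,k,λ)-BIBD on {1..v} (points Fin v)
IsBIBD : (v k λ' : ℕ) → ∀ {b} → (Fin b → Subset v) → Set
IsBIBD v k λ' {b} β =
  (∀ i j → β i ≡ β j → i ≡ j)
  × (∀ i → ∣ β i ∣ ≡ k)
  × (∀ (x y : Fin v) → x ≢ y → count (λ i → mem x (β i) ∧ mem y (β i)) ≡ λ')

-- affine: partition into parallel classes (cls i = class of block i, r classes),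
-- each class partitions the point set, and blocks in different classes meet in μ points
IsAffine : ∀ {v b} → (Fin b → Subset v) → Set
IsAffine {v} {b} β =
  Σ ℕ λ r → Σ (Fin b → Fin r) λ cls →
    (∀ (c : Fin r) (x : Fin v) → count (λ i → does (cls i ≟ᶠ c) ∧ mem x (β i)) ≡ 1)
    × Σ ℕ λ μ → (∀ i j → cls i ≢ cls j → ∣ β i ∩ β j ∣ ≡ μ)

IsAffineBIBD : (v k λ' : ℕ) → ∀ {b} → (Fin b → Subset v) → Set
IsAffineBIBD v k λ' β = IsBIBD v k λ' β × IsAffine β

recip : ℕ → ℚ
recip zero = 0ℚ
recip (suc n) = + 1 / suc n

Matrix : ℕ → Set
Matrix d = Fin d → Fin d → ℚ

sumℚ : ∀ {n} → (Fin n → ℚ) → ℚ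
sumℚ {zero} f = 0ℚ
sumℚ {suc n} f = f zero + sumℚ (λ i → f (suc i))

tr : ∀ {d} → Matrix d → ℚ
tr A = sumℚ (λ i → A i i)

_⊗_ : ∀ {d} → Matrix d → Matrix d → Matrix d
(A ⊗ B) i j = sumℚ (λ l → A i l * B l j)

_·_ : ∀ {d} → ℚ → Matrix d → Matrix d
(c · A) i j = c * A i j

-- classical state: diagonal, positive semidefinite (for a diagonal matrix: nonnegative
-- diagonal entries), trace one
IsClassicalState : ∀ {d} → Matrix d → Set
IsClassicalState A =
  (∀ i j → i ≢ j → A i j ≡ 0ℚ) × (∀ i → 0ℚ ≤ A i i) × tr A ≡ 1ℚ

indicator : Bool → ℚ
indicator true = 1ℚ
indicator false = 0ℚ

Dmat : ∀ {d} → Subset d → Matrix d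
Dmat β i j with i ≟ᶠ j
... | Relation.Nullary.yes _ = indicator (mem i β)
... | Relation.Nullary.no _  = 0ℚ

-- orthoplex-bound achieving arrangement of n states in the classical states of dimension D = d-1:
-- n > D+1 = d and max_{j≠l} tr(W_j W_l) = 1/d
OrthoplexBoundAchieving : ∀ {d n} → (Fin n → Matrix d) → Set
OrthoplexBoundAchieving {d} {n} W =
  (∀ j → IsClassicalState (W j))
  × d ℕ.< n
  × (∀ j l → j ≢ l → tr (W j ⊗ W l) ≤ recip d)
  × (Σ (Fin n) λ j → Σ (Fin n) λ l → j ≢ l × tr (W j ⊗ W l) ≡ recip d)

-- Each parallel class of an affine design partitions the points, so every point lies in one
-- block of each of the r classes. Counting the pairs (y, β) with x, y ∈ β for a fixed point x
-- gives r(k − 1) = λ(v − 1); with v = qk and λ(q − 1) = k − 1 this is r(q − 1) = v − 1, and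
-- double counting incidences gives b = rq, whence b(q − 1) = q(v − 1) and b > v.
-- For the states W = D_β / k one has tr(W W′) = |β ∩ β′| / k². Distinct blocks of one class
-- are disjoint, so this is 0; blocks of different classes meet in μ points, and the q blocks
-- of a class cut a block of another class into pieces of size μ, so qμ = k and μ / k² = 1 / v.

module Submission where

open import Defs
open import Algebra.Bundles using (CommutativeMonoid; CommutativeRing)
open import Data.Bool using (Bool; true; false; _∧_)
open import Data.Bool.Properties using (∧-idem)
open import Data.Fin using (Fin; zero; suc; punchOut)
open import Data.Fin.Properties using (punchInᵢ≢i; punchIn-punchOut; any?) renaming (_≟_ to _≟ᶠ_)
open import Data.Fin.Subset using (Subset; _∩_; ∣_∣; inside; outside)
open import Data.Integer using (+_) renaming (_*_ to _ℤ*_; _+_ to _ℤ+_)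
import Data.Integer.Properties as ℤ
open import Data.Integer.Tactic.RingSolver using (solve-∀)
open import Data.Nat as ℕ using (ℕ; zero; suc; _+_; _*_; _∸_; _^_; _≤_; _<_; z≤n; s≤s; NonZero)
import Data.Nat.Properties as ℕ
open import Data.Nat.Coprimality using (1-coprimeTo)
open import Data.Nat.Primality using (prime⇒nonTrivial; prime⇒nonZero)
open import Data.Product using (Σ; ∃-syntax; _×_; _,_)
open import Data.Rational as ℚ using (ℚ; 0ℚ; 1ℚ; 1/_; toℚᵘ)
import Data.Rational.Properties as ℚ
open import Data.Rational.Literals using (fromℤ)
import Data.Rational.Unnormalised as ℚᵘ
import Data.Rational.Unnormalised.Properties as ℚᵘ
open import Data.Vec using (_∷_; [])
open import Data.Vec.Functional using (Vector; removeAt)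
open import Relation.Binary.PropositionalEquality
  using (_≡_; _≢_; refl; sym; trans; cong; cong₂; subst; subst₂; module ≡-Reasoning)
open import Relation.Nullary using (does; yes; no; contradiction)
import Algebra.Properties.CommutativeSemigroup as CommutativeSemigroupProperties
import Algebra.Properties.Semiring.Sum as SemiringSum

fromℕ : ℕ → ℚ
fromℕ n = fromℤ (+ n)

fromℕ-suc : ∀ n → fromℕ (suc n) ≡ 1ℚ ℚ.+ fromℕ n
fromℕ-suc n = ℚ.toℚᵘ-injective (ℚᵘ.≃-sym
  (ℚᵘ.≃-trans (ℚ.toℚᵘ-homo-+ 1ℚ (fromℕ n)) (ℚᵘ.*≡* (cross-multiplied (+ n)))))
  where
  cross-multiplied : ∀ x → (+ 1 ℤ* + 1 ℤ+ x ℤ* + 1) ℤ* + 1 ≡ (+ 1 ℤ+ x) ℤ* + 1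
  cross-multiplied = solve-∀

recip-suc : ∀ n → recip (suc n) ≡ 1/ fromℕ (suc n)
recip-suc n = ℚ.normalize-coprime (1-coprimeTo (suc n))

toℚᵘ-recip : ∀ n → toℚᵘ (recip (suc n)) ℚᵘ.≃ ℚᵘ.mkℚᵘ (+ 1) n
toℚᵘ-recip n = ℚ.toℚᵘ-fromℚᵘ (ℚᵘ.mkℚᵘ (+ 1) n)

recip-nonNeg : ∀ n → 0ℚ ℚ.≤ recip n
recip-nonNeg zero    = ℚ.≤-refl
recip-nonNeg (suc n) = ℚ.nonNegative⁻¹ _ {{ℚ.normalize-nonNeg 1 (suc n)}}

recip-inverseˡ : ∀ n .{{_ : NonZero n}} → recip n ℚ.* fromℕ n ≡ 1ℚ
recip-inverseˡ (suc n) =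
  trans (cong (ℚ._* fromℕ (suc n)) (recip-suc n)) (ℚ.*-inverseˡ (fromℕ (suc n)))

recip²*fromℕ≡recip : ∀ k v μ .{{_ : NonZero k}} → μ * v ≡ k * k →
  recip k ℚ.* recip k ℚ.* fromℕ μ ≡ recip v
recip²*fromℕ≡recip (suc k) zero μ μ0≡kk =
  contradiction (trans (sym μ0≡kk) (ℕ.*-zeroʳ μ)) λ ()
recip²*fromℕ≡recip (suc k) (suc v) μ μv≡kk = ℚ.toℚᵘ-injective (begin
  toℚᵘ (recip (suc k) ℚ.* recip (suc k) ℚ.* fromℕ μ)
    ≈⟨ ℚ.toℚᵘ-homo-* (recip (suc k) ℚ.* recip (suc k)) (fromℕ μ) ⟩
  toℚᵘ (recip (suc k) ℚ.* recip (suc k)) ℚᵘ.* ℚᵘ.mkℚᵘ (+ μ) 0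
    ≈⟨ ℚᵘ.*-congʳ (ℚ.toℚᵘ-homo-* (recip (suc k)) (recip (suc k))) ⟩
  toℚᵘ (recip (suc k)) ℚᵘ.* toℚᵘ (recip (suc k)) ℚᵘ.* ℚᵘ.mkℚᵘ (+ μ) 0
    ≈⟨ ℚᵘ.*-congʳ (ℚᵘ.*-cong (toℚᵘ-recip k) (toℚᵘ-recip k)) ⟩
  ℚᵘ.mkℚᵘ (+ 1) k ℚᵘ.* ℚᵘ.mkℚᵘ (+ 1) k ℚᵘ.* ℚᵘ.mkℚᵘ (+ μ) 0
    ≈⟨ ℚᵘ.*≡* cross-multiplied ⟩
  ℚᵘ.mkℚᵘ (+ 1) v
    ≈⟨ toℚᵘ-recip v ⟨
  toℚᵘ (recip (suc v)) ∎)
  where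
  open ℚᵘ.≃-Reasoning
  cross-multiplied : (+ 1 ℤ* + 1 ℤ* + μ) ℤ* + suc v ≡ + 1 ℤ* + (suc k * suc k * 1)
  cross-multiplied =
    trans (cong (_ℤ* + suc v) (ℤ.*-identityˡ (+ μ)))
    (trans (sym (ℤ.pos-* μ (suc v)))
    (trans (cong +_ (trans μv≡kk (sym (ℕ.*-identityʳ _)))) (sym (ℤ.*-identityˡ _))))

module _ {a ℓ} (M : CommutativeMonoid a ℓ) where
  open CommutativeMonoid M
    renaming (_∙_ to _⊕_; ε to 0#; ∙-congˡ to ⊕-congˡ; identityʳ to ⊕-identityʳ; sym to ≈-sym)
  open import Algebra.Properties.CommutativeMonoid.Sum M
  open import Algebra.Definitions.RawMonoid rawMonoid using () renaming (_×_ to _×ₙ_)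
  open import Relation.Binary.Reasoning.Setoid setoid

  sum-constant-except : ∀ {n} (f : Vector Carrier n) i {c} → (∀ j → j ≢ i → f j ≈ c) →
    sum f ≈ f i ⊕ (n ∸ 1) ×ₙ c
  sum-constant-except {suc n} f i {c} f≈c = begin
    sum f                      ≈⟨ sum-remove f ⟩
    f i ⊕ sum (removeAt f i)   ≈⟨ ⊕-congˡ (sum-cong-≋ (λ j → f≈c _ (punchInᵢ≢i i j))) ⟩
    f i ⊕ sum {n} (λ _ → c)    ≈⟨ ⊕-congˡ (sum-replicate n) ⟩
    f i ⊕ n ×ₙ c                ∎

  sum-supported-at : ∀ {n} (f : Vector Carrier n) i → (∀ j → j ≢ i → f j ≈ 0#) → sum f ≈ f i
  sum-supported-at {suc n} f i f≈0 = begin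
    sum f                      ≈⟨ sum-constant-except f i f≈0 ⟩
    f i ⊕ n ×ₙ 0#               ≈⟨ ⊕-congˡ (≈-sym (sum-replicate n)) ⟩
    f i ⊕ sum {n} (λ _ → 0#)   ≈⟨ ⊕-congˡ (sum-replicate-zero n) ⟩
    f i ⊕ 0#                   ≈⟨ ⊕-identityʳ (f i) ⟩
    f i                        ∎

open SemiringSum ℕ.+-*-semiring
  using (sum; sum-syntax; ∑-comm; *-distribˡ-sum; *-distribʳ-sum; sum-cong-≗; sum-remove;
         sum-replicate; sum-replicate-zero)
module ℚΣ = SemiringSum (CommutativeRing.semiring ℚ.+-*-commutativeRing)

sumℚ≡sum : ∀ {n} (f : Fin n → ℚ) → sumℚ f ≡ ℚΣ.sum f
sumℚ≡sum {zero}  f = refl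
sumℚ≡sum {suc n} f = cong (f zero ℚ.+_) (sumℚ≡sum (λ i → f (suc i)))

open import Algebra.Definitions.RawMonoid ℕ.+-0-rawMonoid using () renaming (_×_ to _×ℕ_)

×ℕ≡* : ∀ n c → n ×ℕ c ≡ n * c
×ℕ≡* zero    c = refl
×ℕ≡* (suc n) c = cong (_+_ c) (×ℕ≡* n c)

sum-const : ∀ n c → ∑[ i < n ] c ≡ n * c
sum-const n c = trans (sum-replicate n) (×ℕ≡* n c)

∑-*-∑ : ∀ {m n} (a : Fin m → ℕ) (g : Fin m → Fin n → ℕ) →
  ∑[ i < m ] (a i * ∑[ j < n ] g i j) ≡ ∑[ j < n ] ∑[ i < m ] (a i * g i j)
∑-*-∑ a g = trans (sum-cong-≗ (λ i → *-distribˡ-sum (a i) (g i))) (∑-comm (λ i j → a i * g i j))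

∑-∑-* : ∀ {m n} (a : Fin m → ℕ) (g : Fin m → Fin n → ℕ) →
  ∑[ i < m ] (∑[ j < n ] g i j * a i) ≡ ∑[ j < n ] ∑[ i < m ] (g i j * a i)
∑-∑-* a g = trans (sum-cong-≗ (λ i → *-distribʳ-sum (a i) (g i))) (∑-comm (λ i j → g i j * a i))

term≤sum : ∀ {n} (f : Fin n → ℕ) i → f i ≤ sum f
term≤sum {suc n} f i = ℕ.≤-trans (ℕ.m≤m+n (f i) _) (ℕ.≤-reflexive (sym (sum-remove f)))

two-terms≤sum : ∀ {n} (f : Fin n → ℕ) {i j} → i ≢ j → f i + f j ≤ sum f
two-terms≤sum {suc n} f {i} {j} i≢j = ℕ.≤-trans
  (ℕ.+-monoʳ-≤ (f i) (subst (_≤ sum (removeAt f i)) (cong f (punchIn-punchOut i≢j))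
                              (term≤sum (removeAt f i) (punchOut i≢j))))
  (ℕ.≤-reflexive (sym (sum-remove f)))

indicatorℕ : Bool → ℕ
indicatorℕ true  = 1
indicatorℕ false = 0

indicatorℕ-∧ : ∀ a b → indicatorℕ (a ∧ b) ≡ indicatorℕ a * indicatorℕ b
indicatorℕ-∧ true  b = sym (ℕ.+-identityʳ (indicatorℕ b))
indicatorℕ-∧ false b = refl

indicator-∧ : ∀ a b → indicator (a ∧ b) ≡ indicator a ℚ.* indicator b
indicator-∧ true  b = sym (ℚ.*-identityˡ (indicator b))
indicator-∧ false b = sym (ℚ.*-zeroˡ (indicator b))

count≡sum : ∀ {n} (P : Fin n → Bool) → count P ≡ ∑[ i < n ] indicatorℕ (P i)
count≡sum {zero}  P = refl
count≡sum {suc n} P with P zero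
... | true  = cong suc (count≡sum (λ i → P (suc i)))
... | false = count≡sum (λ i → P (suc i))

mem-∩ : ∀ {n} x (β β′ : Subset n) → mem x (β ∩ β′) ≡ mem x β ∧ mem x β′
mem-∩ zero    (inside  ∷ β) (inside  ∷ β′) = refl
mem-∩ zero    (inside  ∷ β) (outside ∷ β′) = refl
mem-∩ zero    (outside ∷ β) (_       ∷ β′) = refl
mem-∩ (suc x) (_       ∷ β) (_       ∷ β′) = mem-∩ x β β′

∣∣≡sum : ∀ {n} (β : Subset n) → ∣ β ∣ ≡ ∑[ x < n ] indicatorℕ (mem x β)
∣∣≡sum []            = refl
∣∣≡sum (inside  ∷ β) = cong suc (∣∣≡sum β)
∣∣≡sum (outside ∷ β) = ∣∣≡sum β

fromℕ∣∣≡sum : ∀ {n} (β : Subset n) → fromℕ ∣ β ∣ ≡ ℚΣ.sum (λ x → indicator (mem x β))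
fromℕ∣∣≡sum []            = refl
fromℕ∣∣≡sum (inside  ∷ β) = trans (fromℕ-suc ∣ β ∣) (cong (1ℚ ℚ.+_) (fromℕ∣∣≡sum β))
fromℕ∣∣≡sum (outside ∷ β) = trans (fromℕ∣∣≡sum β) (sym (ℚ.+-identityˡ _))

Dmat-diagonal : ∀ {d} (β : Subset d) i → Dmat β i i ≡ indicator (mem i β)
Dmat-diagonal β i with i ≟ᶠ i
... | yes _   = refl
... | no  i≢i = contradiction refl i≢i

Dmat-offDiagonal : ∀ {d} (β : Subset d) {i j} → i ≢ j → Dmat β i j ≡ 0ℚ
Dmat-offDiagonal β {i} {j} i≢j with i ≟ᶠ j
... | yes i≡j = contradiction i≡j i≢j
... | no  _   = refl

tr-indicator-diagonal : ∀ {d} (A : Matrix d) c (γ : Subset d) →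
  (∀ i → A i i ≡ c ℚ.* indicator (mem i γ)) → tr A ≡ c ℚ.* fromℕ ∣ γ ∣
tr-indicator-diagonal A c γ diag = begin
  sumℚ (λ i → A i i)                         ≡⟨ sumℚ≡sum (λ i → A i i) ⟩
  ℚΣ.sum (λ i → A i i)                       ≡⟨ ℚΣ.sum-cong-≗ diag ⟩
  ℚΣ.sum (λ i → c ℚ.* indicator (mem i γ))   ≡⟨ ℚΣ.*-distribˡ-sum c (λ i → indicator (mem i γ)) ⟨
  c ℚ.* ℚΣ.sum (λ i → indicator (mem i γ))   ≡⟨ cong (c ℚ.*_) (fromℕ∣∣≡sum γ) ⟨
  c ℚ.* fromℕ ∣ γ ∣                           ∎
  where open ≡-Reasoning

tr-·-Dmat : ∀ {d} c (β : Subset d) → tr (c · Dmat β) ≡ c ℚ.* fromℕ ∣ β ∣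
tr-·-Dmat c β = tr-indicator-diagonal (c · Dmat β) c β (λ i → cong (c ℚ.*_) (Dmat-diagonal β i))

·-Dmat-⊗-diagonal : ∀ {d} c c′ (β β′ : Subset d) i →
  ((c · Dmat β) ⊗ (c′ · Dmat β′)) i i ≡ (c ℚ.* c′) ℚ.* indicator (mem i (β ∩ β′))
·-Dmat-⊗-diagonal c c′ β β′ i = begin
  sumℚ (λ l → (c ℚ.* Dmat β i l) ℚ.* (c′ ℚ.* Dmat β′ l i))
    ≡⟨ sumℚ≡sum (λ l → (c ℚ.* Dmat β i l) ℚ.* (c′ ℚ.* Dmat β′ l i)) ⟩
  ℚΣ.sum (λ l → (c ℚ.* Dmat β i l) ℚ.* (c′ ℚ.* Dmat β′ l i))
    ≡⟨ sum-supported-at ℚ.+-0-commutativeMonoid _ i off-diagonal ⟩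
  (c ℚ.* Dmat β i i) ℚ.* (c′ ℚ.* Dmat β′ i i)
    ≡⟨ cong₂ (λ a b → (c ℚ.* a) ℚ.* (c′ ℚ.* b)) (Dmat-diagonal β i) (Dmat-diagonal β′ i) ⟩
  (c ℚ.* indicator (mem i β)) ℚ.* (c′ ℚ.* indicator (mem i β′))
    ≡⟨ interchange c (indicator (mem i β)) c′ (indicator (mem i β′)) ⟩
  (c ℚ.* c′) ℚ.* (indicator (mem i β) ℚ.* indicator (mem i β′))
    ≡⟨ cong ((c ℚ.* c′) ℚ.*_) (trans (sym (indicator-∧ (mem i β) (mem i β′))) (cong indicator (sym (mem-∩ i β β′)))) ⟩
  (c ℚ.* c′) ℚ.* indicator (mem i (β ∩ β′)) ∎
  where
  open ≡-Reasoning
  open CommutativeSemigroupProperties (CommutativeMonoid.commutativeSemigroup ℚ.*-1-commutativeMonoid) using (interchange)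
  off-diagonal : ∀ l → l ≢ i → (c ℚ.* Dmat β i l) ℚ.* (c′ ℚ.* Dmat β′ l i) ≡ 0ℚ
  off-diagonal l l≢i = begin
    (c ℚ.* Dmat β i l) ℚ.* (c′ ℚ.* Dmat β′ l i) ≡⟨ cong (λ a → (c ℚ.* a) ℚ.* (c′ ℚ.* Dmat β′ l i)) (Dmat-offDiagonal β (λ i≡l → l≢i (sym i≡l))) ⟩
    (c ℚ.* 0ℚ) ℚ.* (c′ ℚ.* Dmat β′ l i)          ≡⟨ cong (ℚ._* (c′ ℚ.* Dmat β′ l i)) (ℚ.*-zeroʳ c) ⟩
    0ℚ ℚ.* (c′ ℚ.* Dmat β′ l i)                  ≡⟨ ℚ.*-zeroˡ (c′ ℚ.* Dmat β′ l i) ⟩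
    0ℚ                                            ∎

tr-·-Dmat-⊗ : ∀ {d} c c′ (β β′ : Subset d) →
  tr ((c · Dmat β) ⊗ (c′ · Dmat β′)) ≡ (c ℚ.* c′) ℚ.* fromℕ ∣ β ∩ β′ ∣
tr-·-Dmat-⊗ c c′ β β′ = tr-indicator-diagonal ((c · Dmat β) ⊗ (c′ · Dmat β′)) (c ℚ.* c′) (β ∩ β′) (·-Dmat-⊗-diagonal c c′ β β′)

·-Dmat-classical : ∀ {d} c (β : Subset d) → 0ℚ ℚ.≤ c → c ℚ.* fromℕ ∣ β ∣ ≡ 1ℚ →
  IsClassicalState (c · Dmat β)
·-Dmat-classical c β 0≤c c∣β∣≡1 =
    (λ i j i≢j → trans (cong (c ℚ.*_) (Dmat-offDiagonal β i≢j)) (ℚ.*-zeroʳ c))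
  , (λ i → subst (λ x → 0ℚ ℚ.≤ c ℚ.* x) (sym (Dmat-diagonal β i)) (scaled-indicator-nonNeg (mem i β)))
  , trans (tr-·-Dmat c β) c∣β∣≡1
  where
  scaled-indicator-nonNeg : ∀ a → 0ℚ ℚ.≤ c ℚ.* indicator a
  scaled-indicator-nonNeg true  = subst (0ℚ ℚ.≤_) (sym (ℚ.*-identityʳ c)) 0≤c
  scaled-indicator-nonNeg false = subst (0ℚ ℚ.≤_) (sym (ℚ.*-zeroʳ c)) ℚ.≤-refl

distinct-pair : ∀ {n} → 2 ≤ n → Σ (Fin n) λ a → Σ (Fin n) λ b → a ≢ b
distinct-pair (s≤s (s≤s _)) = zero , suc zero , λ ()

-- Incidences are encoded as 0/1-valued natural numbers, so that each counting argument
-- becomes an exchange of two finite sums.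
module AffineDesign {v k λ′ b r μ} (β : Fin b → Subset v) (cls : Fin b → Fin r)
  (block-size : ∀ i → ∣ β i ∣ ≡ k)
  (pair-count : ∀ x y → x ≢ y → count (λ i → mem x (β i) ∧ mem y (β i)) ≡ λ′)
  (resolution : ∀ c x → count (λ i → does (cls i ≟ᶠ c) ∧ mem x (β i)) ≡ 1)
  (cross-intersection : ∀ i j → cls i ≢ cls j → ∣ β i ∩ β j ∣ ≡ μ)
  where

  open ≡-Reasoning

  inc : Fin v → Fin b → ℕ
  inc x i = indicatorℕ (mem x (β i))

  inClass : Fin b → Fin r → ℕ
  inClass i c = indicatorℕ (does (cls i ≟ᶠ c))

  classSize : Fin r → ℕ
  classSize c = ∑[ i < b ] inClass i c

  inClass-own : ∀ i → inClass i (cls i) ≡ 1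
  inClass-own i with cls i ≟ᶠ cls i
  ... | yes _ = refl
  ... | no ci≢ci = contradiction refl ci≢ci

  inClass-other : ∀ i {c} → cls i ≢ c → inClass i c ≡ 0
  inClass-other i {c} ci≢c with cls i ≟ᶠ c
  ... | yes ci≡c = contradiction ci≡c ci≢c
  ... | no _ = refl

  ∑-inc-block : ∀ i → ∑[ x < v ] inc x i ≡ k
  ∑-inc-block i = trans (sym (∣∣≡sum (β i))) (block-size i)

  ∑-inc-inc : ∀ i j → ∑[ x < v ] (inc x i * inc x j) ≡ ∣ β i ∩ β j ∣
  ∑-inc-inc i j = sym (trans (∣∣≡sum (β i ∩ β j)) (sum-cong-≗ λ x →
    trans (cong indicatorℕ (mem-∩ x (β i) (β j))) (indicatorℕ-∧ (mem x (β i)) (mem x (β j)))))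

  ∑-inc-pair : ∀ x y → x ≢ y → ∑[ i < b ] (inc x i * inc y i) ≡ λ′
  ∑-inc-pair x y x≢y = trans
    (sum-cong-≗ λ i → sym (indicatorℕ-∧ (mem x (β i)) (mem y (β i))))
    (trans (sym (count≡sum (λ i → mem x (β i) ∧ mem y (β i)))) (pair-count x y x≢y))

  ∑-inClass-inc : ∀ c x → ∑[ i < b ] (inClass i c * inc x i) ≡ 1
  ∑-inClass-inc c x = trans
    (sum-cong-≗ λ i → sym (indicatorℕ-∧ (does (cls i ≟ᶠ c)) (mem x (β i))))
    (trans (sym (count≡sum (λ i → does (cls i ≟ᶠ c) ∧ mem x (β i)))) (resolution c x))

  ∑-inClass : ∀ i → ∑[ c < r ] inClass i c ≡ 1
  ∑-inClass i = trans (sum-supported-at ℕ.+-0-commutativeMonoid (inClass i) (cls i)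
    (λ c c≢ci → inClass-other i (λ ci≡c → c≢ci (sym ci≡c)))) (inClass-own i)

  replication : ∀ x → ∑[ i < b ] inc x i ≡ r
  replication x = begin
    ∑[ i < b ] inc x i                               ≡⟨ sum-cong-≗ (λ i → ℕ.*-identityˡ (inc x i)) ⟨
    ∑[ i < b ] (1 * inc x i)                         ≡⟨ sum-cong-≗ (λ i → cong (_* inc x i) (∑-inClass i)) ⟨
    ∑[ i < b ] ((∑[ c < r ] inClass i c) * inc x i)  ≡⟨ ∑-∑-* (inc x) inClass ⟩
    ∑[ c < r ] ∑[ i < b ] (inClass i c * inc x i)    ≡⟨ sum-cong-≗ (λ c → ∑-inClass-inc c x) ⟩
    ∑[ c < r ] 1                                     ≡⟨ sum-const r 1 ⟩
    r * 1                                            ≡⟨ ℕ.*-identityʳ r ⟩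
    r                                                ∎

  -- Both sides count the pairs (y, i) with x, y ∈ β i.
  r*k≡r+[v-1]*λ′ : ∀ x → r * k ≡ r + (v ∸ 1) * λ′
  r*k≡r+[v-1]*λ′ x = begin
    r * k
      ≡⟨ cong (_* k) (replication x) ⟨
    (∑[ i < b ] inc x i) * k
      ≡⟨ *-distribʳ-sum k (inc x) ⟩
    ∑[ i < b ] (inc x i * k)
      ≡⟨ sum-cong-≗ (λ i → cong (inc x i *_) (∑-inc-block i)) ⟨
    ∑[ i < b ] (inc x i * ∑[ y < v ] inc y i)
      ≡⟨ ∑-*-∑ (inc x) (λ i y → inc y i) ⟩
    ∑[ y < v ] ∑[ i < b ] (inc x i * inc y i)
      ≡⟨ sum-constant-except ℕ.+-0-commutativeMonoid _ x
           (λ y y≢x → ∑-inc-pair x y (λ x≡y → y≢x (sym x≡y))) ⟩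
    ∑[ i < b ] (inc x i * inc x i) + (v ∸ 1) ×ℕ λ′
      ≡⟨ cong₂ _+_ (sum-cong-≗ inc-idempotent) (×ℕ≡* (v ∸ 1) λ′) ⟩
    ∑[ i < b ] inc x i + (v ∸ 1) * λ′
      ≡⟨ cong (_+ (v ∸ 1) * λ′) (replication x) ⟩
    r + (v ∸ 1) * λ′ ∎
    where
    inc-idempotent : ∀ i → inc x i * inc x i ≡ inc x i
    inc-idempotent i = trans (sym (indicatorℕ-∧ (mem x (β i)) (mem x (β i))))
                             (cong indicatorℕ (∧-idem (mem x (β i))))

  b*k≡r*v : b * k ≡ r * v
  b*k≡r*v = begin
    b * k                               ≡⟨ sum-const b k ⟨
    ∑[ i < b ] k                        ≡⟨ sum-cong-≗ ∑-inc-block ⟨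
    ∑[ i < b ] ∑[ x < v ] inc x i       ≡⟨ ∑-comm (λ i x → inc x i) ⟩
    ∑[ x < v ] ∑[ i < b ] inc x i       ≡⟨ sum-cong-≗ replication ⟩
    ∑[ x < v ] r                        ≡⟨ sum-const v r ⟩
    v * r                               ≡⟨ ℕ.*-comm v r ⟩
    r * v                               ∎

  classSize*k≡v : ∀ c → classSize c * k ≡ v
  classSize*k≡v c = begin
    classSize c * k
      ≡⟨ *-distribʳ-sum k (λ i → inClass i c) ⟩
    ∑[ i < b ] (inClass i c * k)
      ≡⟨ sum-cong-≗ (λ i → cong (inClass i c *_) (∑-inc-block i)) ⟨
    ∑[ i < b ] (inClass i c * ∑[ x < v ] inc x i)
      ≡⟨ ∑-*-∑ (λ i → inClass i c) (λ i x → inc x i) ⟩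
    ∑[ x < v ] ∑[ i < b ] (inClass i c * inc x i)
      ≡⟨ sum-cong-≗ (∑-inClass-inc c) ⟩
    ∑[ x < v ] 1
      ≡⟨ sum-const v 1 ⟩
    v * 1
      ≡⟨ ℕ.*-identityʳ v ⟩
    v ∎

  -- The blocks of class c partition β i into pieces of size μ.
  classSize*μ≡k : ∀ i c → cls i ≢ c → classSize c * μ ≡ k
  classSize*μ≡k i c ci≢c = begin
    classSize c * μ
      ≡⟨ *-distribʳ-sum μ (λ j → inClass j c) ⟩
    ∑[ j < b ] (inClass j c * μ)
      ≡⟨ sum-cong-≗ meets-in-μ ⟩
    ∑[ j < b ] (inClass j c * ∑[ x < v ] (inc x i * inc x j))
      ≡⟨ ∑-*-∑ (λ j → inClass j c) (λ j x → inc x i * inc x j) ⟩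
    ∑[ x < v ] ∑[ j < b ] (inClass j c * (inc x i * inc x j))
      ≡⟨ sum-cong-≗ (λ x → sum-cong-≗ (λ j → x∙yz≈y∙xz (inClass j c) (inc x i) (inc x j))) ⟩
    ∑[ x < v ] ∑[ j < b ] (inc x i * (inClass j c * inc x j))
      ≡⟨ sum-cong-≗ (λ x → *-distribˡ-sum (inc x i) (λ j → inClass j c * inc x j)) ⟨
    ∑[ x < v ] (inc x i * ∑[ j < b ] (inClass j c * inc x j))
      ≡⟨ sum-cong-≗ (λ x → cong (inc x i *_) (∑-inClass-inc c x)) ⟩
    ∑[ x < v ] (inc x i * 1)
      ≡⟨ sum-cong-≗ (λ x → ℕ.*-identityʳ (inc x i)) ⟩
    ∑[ x < v ] inc x i
      ≡⟨ ∑-inc-block i ⟩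
    k ∎
    where
    open CommutativeSemigroupProperties ℕ.*-commutativeSemigroup using (x∙yz≈y∙xz)
    meets-in-μ : ∀ j → inClass j c * μ ≡ inClass j c * ∑[ x < v ] (inc x i * inc x j)
    meets-in-μ j with cls j ≟ᶠ c
    ... | yes cj≡c = cong (1 *_) (sym (trans (∑-inc-inc i j)
                       (cross-intersection i j (λ ci≡cj → ci≢c (trans ci≡cj cj≡c)))))
    ... | no  _    = refl

  μ*v≡k*k : ∀ i j → cls i ≢ cls j → μ * v ≡ k * k
  μ*v≡k*k i j ci≢cj = begin
    μ * v                      ≡⟨ cong (μ *_) (classSize*k≡v (cls j)) ⟨
    μ * (classSize (cls j) * k) ≡⟨ ℕ.*-assoc μ (classSize (cls j)) k ⟨
    μ * classSize (cls j) * k   ≡⟨ cong (_* k) (ℕ.*-comm μ (classSize (cls j))) ⟩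
    classSize (cls j) * μ * k   ≡⟨ cong (_* k) (classSize*μ≡k i (cls j) ci≢cj) ⟩
    k * k                      ∎

  parallel-disjoint : ∀ i j → i ≢ j → cls i ≡ cls j → ∣ β i ∩ β j ∣ ≡ 0
  parallel-disjoint i j i≢j ci≡cj =
    trans (sym (∑-inc-inc i j)) (trans (sum-cong-≗ no-common-point) (sum-replicate-zero v))
    where
    counted-once : ∀ x l → cls l ≡ cls i → mem x (β l) ≡ true → inClass l (cls i) * inc x l ≡ 1
    counted-once x l cl≡ci x∈βl rewrite cl≡ci | x∈βl = trans (ℕ.*-identityʳ _) (inClass-own i)
    no-common-point : ∀ x → inc x i * inc x j ≡ 0
    no-common-point x with mem x (β i) in x∈βi | mem x (β j) in x∈βj
    ... | false | _     = refl
    ... | true  | false = refl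
    ... | true  | true  = contradiction
      (subst₂ _≤_ (cong₂ _+_ (counted-once x i refl x∈βi) (counted-once x j (sym ci≡cj) x∈βj))
                  (∑-inClass-inc (cls i) x)
                  (two-terms≤sum (λ l → inClass l (cls i) * inc x l) i≢j))
      λ { (s≤s ()) }

  class-inhabited : Fin v → ∀ c → ∃[ i ] cls i ≡ c
  class-inhabited x c with any? (λ i → cls i ≟ᶠ c)
  ... | yes inhabited = inhabited
  ... | no  empty     = contradiction (trans (sym no-incidence) (∑-inClass-inc c x)) λ ()
    where
    no-incidence : ∑[ i < b ] (inClass i c * inc x i) ≡ 0
    no-incidence = trans
      (sum-cong-≗ (λ i → cong (_* inc x i) (inClass-other i (λ ci≡c → empty (i , ci≡c)))))
      (sum-replicate-zero b)

  W : Fin b → Matrix v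
  W i = recip k · Dmat (β i)

  W-classical : .{{_ : NonZero k}} → ∀ i → IsClassicalState (W i)
  W-classical i = ·-Dmat-classical (recip k) (β i) (recip-nonNeg k)
    (trans (cong (λ n → recip k ℚ.* fromℕ n) (block-size i)) (recip-inverseˡ k))

  tr-W⊗W-cross : .{{_ : NonZero k}} → ∀ i j → cls i ≢ cls j → tr (W i ⊗ W j) ≡ recip v
  tr-W⊗W-cross i j ci≢cj = begin
    tr (W i ⊗ W j)
      ≡⟨ tr-·-Dmat-⊗ (recip k) (recip k) (β i) (β j) ⟩
    recip k ℚ.* recip k ℚ.* fromℕ ∣ β i ∩ β j ∣
      ≡⟨ cong (λ n → recip k ℚ.* recip k ℚ.* fromℕ n) (cross-intersection i j ci≢cj) ⟩
    recip k ℚ.* recip k ℚ.* fromℕ μ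
      ≡⟨ recip²*fromℕ≡recip k v μ (μ*v≡k*k i j ci≢cj) ⟩
    recip v ∎

  tr-W⊗W-parallel : ∀ i j → i ≢ j → cls i ≡ cls j → tr (W i ⊗ W j) ≡ 0ℚ
  tr-W⊗W-parallel i j i≢j ci≡cj = begin
    tr (W i ⊗ W j)
      ≡⟨ tr-·-Dmat-⊗ (recip k) (recip k) (β i) (β j) ⟩
    recip k ℚ.* recip k ℚ.* fromℕ ∣ β i ∩ β j ∣
      ≡⟨ cong (λ n → recip k ℚ.* recip k ℚ.* fromℕ n) (parallel-disjoint i j i≢j ci≡cj) ⟩
    recip k ℚ.* recip k ℚ.* 0ℚ
      ≡⟨ ℚ.*-zeroʳ (recip k ℚ.* recip k) ⟩
    0ℚ ∎

  cross-pair : Fin v → 2 ≤ r → ∃[ i ] ∃[ j ] cls i ≢ cls j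
  cross-pair x₀ 2≤r with distinct-pair 2≤r
  ... | c , c′ , c≢c′ with class-inhabited x₀ c | class-inhabited x₀ c′
  ...   | i , ci≡c | j , cj≡c′ = i , j , λ ci≡cj → c≢c′ (trans (sym ci≡c) (trans ci≡cj cj≡c′))

  W-orthoplex : .{{_ : NonZero k}} → Fin v → 2 ≤ r → v < b → OrthoplexBoundAchieving W
  W-orthoplex x₀ 2≤r v<b with cross-pair x₀ 2≤r
  ... | i , j , ci≢cj =
    W-classical , v<b , overlap≤ , i , j , (λ i≡j → ci≢cj (cong cls i≡j)) , tr-W⊗W-cross i j ci≢cj
    where
    overlap≤ : ∀ i j → i ≢ j → tr (W i ⊗ W j) ℚ.≤ recip v
    overlap≤ i j i≢j with cls i ≟ᶠ cls j
    ... | yes ci≡cj = subst (ℚ._≤ recip v) (sym (tr-W⊗W-parallel i j i≢j ci≡cj)) (recip-nonNeg v)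
    ... | no  ci≢cj = ℚ.≤-reflexive (tr-W⊗W-cross i j ci≢cj)

prime-power≥2 : ∀ {q} → IsPrimePower q → 2 ≤ q
prime-power≥2 (p , suc e , p-prime , _ , refl) = ℕ.≤-trans
  (ℕ.nonTrivial⇒n>1 p {{prime⇒nonTrivial p-prime}})
  (ℕ.m≤m*n p (p ^ e) {{ℕ.m^n≢0 p e {{prime⇒nonZero p-prime}}}})

replication-number : ∀ {r k λ′ s n} .{{_ : NonZero k}} →
  r * suc k ≡ r + n * λ′ → λ′ * s ≡ k → r * s ≡ n
replication-number {k = k} {zero} _ 0≡k = contradiction (sym 0≡k) (ℕ.≢-nonZero⁻¹ k)
replication-number {r} {k} {λ′@(suc _)} {s} {n} r[k+1]≡r+nλ′ λ′s≡k =
  ℕ.*-cancelˡ-≡ (r * s) n λ′ (begin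
    λ′ * (r * s)  ≡⟨ x∙yz≈y∙xz λ′ r s ⟩
    r * (λ′ * s)  ≡⟨ cong (r *_) λ′s≡k ⟩
    r * k         ≡⟨ ℕ.+-cancelˡ-≡ r _ _ (trans (sym (ℕ.*-suc r k)) r[k+1]≡r+nλ′) ⟩
    n * λ′        ≡⟨ ℕ.*-comm n λ′ ⟩
    λ′ * n        ∎)
  where
  open ≡-Reasoning
  open CommutativeSemigroupProperties ℕ.*-commutativeSemigroup using (x∙yz≈y∙xz)

affine-parameters : ∀ {q k λ′ r b} → 2 ≤ q → 2 ≤ k → λ′ * (q ∸ 1) ≡ k ∸ 1 →
  r * k ≡ r + (q * k ∸ 1) * λ′ → b * k ≡ r * (q * k) →
  b * (q ∸ 1) ≡ q * (q * k ∸ 1) × 2 ≤ r × q * k < b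
affine-parameters {suc s} {k@(suc (suc _))} {λ′} {r} {b} (s≤s (s≤s _)) (s≤s (s≤s _))
  λ′s≡k-1 r*k≡r+[v-1]*λ′ b*k≡r*v = b*s≡q*[v-1] , 2≤r , v<b
  where
  open ≡-Reasoning
  open CommutativeSemigroupProperties ℕ.*-commutativeSemigroup using (xy∙z≈y∙xz)
  q v : ℕ
  q = suc s
  v = q * k
  r*s≡v-1 : r * s ≡ v ∸ 1
  r*s≡v-1 = replication-number {r = r} {λ′ = λ′} {s = s} r*k≡r+[v-1]*λ′ λ′s≡k-1
  b≡r*q : b ≡ r * q
  b≡r*q = ℕ.*-cancelʳ-≡ b (r * q) k (trans b*k≡r*v (sym (ℕ.*-assoc r q k)))
  b*s≡q*[v-1] : b * s ≡ q * (v ∸ 1)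
  b*s≡q*[v-1] = begin
    b * s        ≡⟨ cong (_* s) b≡r*q ⟩
    r * q * s    ≡⟨ xy∙z≈y∙xz r q s ⟩
    q * (r * s)  ≡⟨ cong (q *_) r*s≡v-1 ⟩
    q * (v ∸ 1)  ∎
  at-least-two : ∀ r → r * s ≡ v ∸ 1 → 2 ≤ r
  at-least-two (suc (suc _)) _ = s≤s (s≤s z≤n)
  at-least-two (suc zero) s+0≡v-1 = contradiction (trans (sym (ℕ.+-identityʳ s)) s+0≡v-1)
    (ℕ.<⇒≢ (s≤s (ℕ.≤-trans (ℕ.m≤m*n s k) (ℕ.m≤n+m (s * k) _))))
  2≤r : 2 ≤ r
  2≤r = at-least-two r r*s≡v-1
  v<b : v < b
  v<b = subst (v <_) (sym (trans b≡r*q (trans (ℕ.*-suc r s) (cong (_+_ r) r*s≡v-1))))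
    (ℕ.+-monoˡ-< (v ∸ 1) 2≤r)

affine-block-states-orthoplex : ∀ {q k λ′ b} → 2 ≤ q → 2 ≤ k → λ′ * (q ∸ 1) ≡ k ∸ 1 →
  (β : Fin b → Subset (q * k)) → IsAffineBIBD (q * k) k λ′ β →
  b * (q ∸ 1) ≡ q * (q * k ∸ 1) × OrthoplexBoundAchieving (λ i → recip k · Dmat (β i))
affine-block-states-orthoplex 2≤q@(s≤s (s≤s _)) 2≤k@(s≤s (s≤s _)) λ′[q-1]≡k-1 β
  ((_ , block-size , pair-count) , _ , cls , resolution , _ , cross-intersection) =
  let (b[q-1]≡q[v-1] , 2≤r , v<b) =
        affine-parameters 2≤q 2≤k λ′[q-1]≡k-1 (r*k≡r+[v-1]*λ′ zero) b*k≡r*v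
  in  b[q-1]≡q[v-1] , W-orthoplex zero 2≤r v<b
  where open AffineDesign β cls block-size pair-count resolution cross-intersection

corollary2p24 : (m q λ' b : ℕ) → 2 ≤ m → IsPrimePower q →
    λ' * (q ∸ 1) ≡ q ^ (m ∸ 1) ∸ 1 →
    (𝒜 : Fin b → Subset (q ^ m)) → IsAffineBIBD (q ^ m) (q ^ (m ∸ 1)) λ' 𝒜 →
    b * (q ∸ 1) ≡ q * (q ^ m ∸ 1)
      × OrthoplexBoundAchieving (λ i → recip (q ^ (m ∸ 1)) · Dmat (𝒜 i))
corollary2p24 (suc (suc m)) q λ' b (s≤s (s≤s z≤n)) q-prime-power =
  affine-block-states-orthoplex 2≤q (ℕ.≤-trans 2≤q (ℕ.m≤m*n q (q ^ m) {{ℕ.m^n≢0 q m}}))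
  where
  2≤q : 2 ≤ q
  2≤q = prime-power≥2 q-prime-power
  instance
    _ : NonZero q
    _ = ℕ.>-nonZero (ℕ.≤-trans (s≤s z≤n) 2≤q)
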